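{- Let $\rho$ be a right corner of extent $e$ starting at position $k$, and let $d\in\{1,\dots,e\}$. Then $\rho$ has a subpath $\rho'$ which is a basic right corner of extent $d$ starting at position $k+e-d$.
   Context: Let $R(\mathbf{x},\mathbf{x}')$ be a difference bounds constraint over $\mathbf{x}=\{x_1,\dots,x_N\}$ (a finite conjunction of atoms $u-v\le c$, $c\in\mathbb{Z}$, with constraint graph having an edge $u\xrightarrow{c}v$ per atom). With fresh copies $x_i^{(p)}$, $p\in\mathbb{Z}$ (position $p$), the bi-infinite unfolding is the union over all $p$ of the constraint graphs of $R(\mathbf{x}^{(p)},\mathbf{x}^{(p+1)})$; all paths are in it, subpaths are contiguous. A corner is a path $x_{i_0}^{(k_0)}\to\cdots\to x_{i_m}^{(k_m)}$, $m\ge1$, with $k_0=k_m$ (it starts at position $k_0$); it is a right corner of extent $d$ if its positions are $\{k_0,\dots,k_0+d\}$; it is basic if $k_0\notin\{k_1,\dots,k_{m-1}\}$. -}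

module Defs where

open import Data.Nat using (ℕ)
open import Data.Integer using (ℤ; +_; _+_; _≤_)
open import Data.Fin using (Fin)
open import Data.Sum using (_⊎_; inj₁; inj₂)
open import Data.Product using (_×_; _,_; Σ; ∃; ∃-syntax; proj₁; proj₂)
open import Data.List using (List; []; _∷_; _++_; [_]; map; length)
open import Data.List.Membership.Propositional using (_∈_; _∉_)
open import Data.List.Relation.Unary.Linked using (Linked)
open import Relation.Binary.PropositionalEquality using (_≡_)
open import Function.Bundles using (_⇔_)

-- Variables of R(x, x'): inj₁ i is x_i (unprimed), inj₂ i is x'_i (primed).
Var : ℕ → Set
Var N = Fin N ⊎ Fin N

-- An atom  u - v ≤ c ; it gives the edge u --c--> v in the constraint graph.
record Atom (N : ℕ) : Set where
  constructor atom
  field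
    lhs : Var N
    rhs : Var N
    bound : ℤ

DBC : ℕ → Set
DBC N = List (Atom N)

-- Nodes of the bi-infinite unfolding: x_i^(p) is (i , p).
Node : ℕ → Set
Node N = Fin N × ℤ

position : ∀ {N} → Node N → ℤ
position = proj₂

-- copy of a variable of R(x^(p), x^(p+1))
place : ∀ {N} → ℤ → Var N → Node N
place p (inj₁ i) = i , p
place p (inj₂ i) = i , p + + 1

-- Edges of the unfolding: union over p of the constraint graphs of R(x^(p), x^(p+1)).
-- Edge R a b c : there is an edge a --c--> b in the unfolding.
data Edge {N : ℕ} (R : DBC N) : Node N → Node N → Set where
  edge : ∀ (p : ℤ) (at : Atom N) → at ∈ R →
         Edge R (place p (Atom.lhs at)) (place p (Atom.rhs at))

-- A path with m ≥ 1 edges, given by its vertex sequence (length ≥ 2),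
-- consecutive vertices joined by an edge of the unfolding.
record IsPath {N : ℕ} (R : DBC N) (ρ : List (Node N)) : Set where
  field
    atLeastOneEdge : 2 Data.Nat.≤ length ρ
    consecutive    : Linked (Edge R) ρ

positions : ∀ {N} → List (Node N) → List ℤ
positions = map position

Subpath : ∀ {N} → List (Node N) → List (Node N) → Set
Subpath ρ' ρ = ∃[ xs ] ∃[ ys ] ρ ≡ xs ++ ρ' ++ ys

record IsCorner {N : ℕ} (R : DBC N) (k : ℤ) (ρ : List (Node N)) : Set where
  field
    isPath : IsPath R ρ
    first  : Node N
    middle : List (Node N)
    last   : Node N
    shape  : ρ ≡ first ∷ middle ++ [ last ]
    firstPos : position first ≡ k
    lastPos  : position last ≡ k

record IsRightCorner {N : ℕ} (R : DBC N) (k : ℤ) (d : ℕ) (ρ : List (Node N)) : Set where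
  field
    corner : IsCorner R k ρ
    positionSet : ∀ (q : ℤ) → (q ∈ positions ρ) ⇔ ((k ≤ q) × (q ≤ k + + d))

IsBasic : ∀ {N} → List (Node N) → Set
IsBasic {N} ρ = ∀ (first : Node N) (middle : List (Node N)) (last : Node N) →
  ρ ≡ first ∷ middle ++ [ last ] → position first ∉ positions middle

module Submission where

-- Every edge of the unfolding joins two copies whose positions lie in a window
-- [p, p + 1], so along any path the position changes by at most one per step.
-- Let t = k + (e - d). A right corner ρ of extent e starting at k visits a vertex m
-- at the top position t + d, while both of its endpoints sit at position k ≤ t.
-- Walking back from m to the last earlier vertex a at height ≤ t, and forward from m
-- to the first later vertex b at height ≤ t, unit steps force a and b to lie exactly
-- at height t, and every vertex strictly between them lies strictly above t.  This
-- excursion ρ' = a … m … b above level t is the required subpath: it is basic since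
-- no inner vertex sits at level t, its positions lie in [t, t + d] because those of
-- ρ do, and it attains every level in between by the discrete intermediate value
-- property of unit-step walks.

open import Defs
open import Data.Nat using (ℕ; _∸_; s≤s; z≤n)
open import Data.Integer using (ℤ; +_; _+_)
open import Data.Product using (_×_; ∃-syntax)

import Data.Nat as ℕ using (_+_)
open import Data.Nat.Properties using (m∸n+n≡m)
open import Data.Integer using (_≤_; _<_; _≤?_; _≟_; 1ℤ; +<+) renaming (suc to sucℤ)
open import Data.Integer.Properties
open import Data.Sum using (inj₁; inj₂)
open import Data.Product using (_,_; proj₁; proj₂)
open import Data.List using (List; []; _∷_; _++_; [_]; map; length)
open import Data.List.Properties using (∷-injectiveˡ; ∷-injectiveʳ; ∷ʳ-injective; ++-assoc)
open import Data.List.Relation.Unary.Any as Any using (Any; here; there; any?)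
open import Data.List.Relation.Unary.All as All using (All; []; _∷_)
import Data.List.Relation.Unary.All.Properties as All
open import Data.List.Relation.Unary.Linked as Linked using (Linked; []; [-]; _∷_)
open import Data.List.Membership.Propositional using (_∈_; lose)
open import Data.List.Membership.Propositional.Properties using (∈-map⁻; ∈-map⁺; ∈-∃++; ∈-++⁺ˡ; ∈-++⁺ʳ)
open import Relation.Binary.PropositionalEquality using (_≡_; refl; sym; trans; cong; subst; module ≡-Reasoning)
open import Relation.Nullary using (¬_; yes; no)
open import Data.Empty using (⊥-elim)
open import Function.Bundles using (mk⇔; Equivalence)

module _ {A : Set} {R : A → A → Set} where

  linkedSuffix : ∀ xs {ys} → Linked R (xs ++ ys) → Linked R ys
  linkedSuffix []       l = l
  linkedSuffix (x ∷ xs) l = linkedSuffix xs (Linked.tail l)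

  linkedPrefix : ∀ xs {ys} → Linked R (xs ++ ys) → Linked R xs
  linkedPrefix []           l = []
  linkedPrefix (x ∷ [])     l = [-]
  linkedPrefix (x ∷ y ∷ xs) l = Linked.head l ∷ linkedPrefix (y ∷ xs) (Linked.tail l)

  linkedInfix : ∀ xs ys {zs} → Linked R (xs ++ ys ++ zs) → Linked R ys
  linkedInfix xs ys l = linkedPrefix ys (linkedSuffix xs l)

lastIn : ∀ {A : Set} (P : List A) {m : A} {S} Q z → P ++ m ∷ S ≡ Q ++ [ z ] → z ∈ m ∷ S
lastIn []          Q       z eq = subst (z ∈_) (sym eq) (∈-++⁺ʳ Q (here refl))
lastIn (p ∷ [])    []      z ()
lastIn (p ∷ _ ∷ _) []      z ()
lastIn (p ∷ P)     (q ∷ Q) z eq = lastIn P Q z (∷-injectiveʳ eq)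

endsAround : ∀ {A : Set} (P : A → Set) {first last m : A} middle xs S →
  first ∷ middle ++ [ last ] ≡ xs ++ m ∷ S → P first → P last → ¬ P m →
  Any P xs × Any P S
endsAround P middle [] S eq pFirst pLast ¬pm = ⊥-elim (¬pm (subst P (∷-injectiveˡ eq) pFirst))
endsAround P {last = last} middle (x ∷ xs) S eq pFirst pLast ¬pm =
  here (subst P (∷-injectiveˡ eq) pFirst) ,
  Any.tail ¬pm (Any.map (λ last≡ → subst P last≡ pLast) (lastIn (x ∷ xs) (_ ∷ middle) last (sym eq)))

regroup : ∀ {A : Set} (xs : List A) a m₁ m m₂ b ys →
  (xs ++ a ∷ m₁) ++ m ∷ m₂ ++ b ∷ ys ≡ xs ++ (a ∷ (m₁ ++ m ∷ m₂) ++ [ b ]) ++ ys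
regroup xs a m₁ m m₂ b ys = begin
  (xs ++ a ∷ m₁) ++ m ∷ m₂ ++ b ∷ ys        ≡⟨ ++-assoc xs (a ∷ m₁) _ ⟩
  xs ++ a ∷ m₁ ++ m ∷ m₂ ++ b ∷ ys          ≡⟨ cong (λ u → xs ++ a ∷ u) (sym (++-assoc m₁ (m ∷ m₂) (b ∷ ys))) ⟩
  xs ++ a ∷ (m₁ ++ m ∷ m₂) ++ b ∷ ys        ≡⟨ cong (λ u → xs ++ a ∷ u) (sym (++-assoc (m₁ ++ m ∷ m₂) [ b ] ys)) ⟩
  xs ++ (a ∷ (m₁ ++ m ∷ m₂) ++ [ b ]) ++ ys  ∎
  where open ≡-Reasoning

<-suc⇒≤ : ∀ {t x} → t < sucℤ x → t ≤ x
<-suc⇒≤ {t} {x} t<sx = subst (t ≤_) (pred-suc x) (i<j⇒i≤pred[j] t<sx)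

module UnitStepWalks {A : Set} (h : A → ℤ) where

  UnitStep : A → A → Set
  UnitStep a b = (h b ≤ sucℤ (h a)) × (h a ≤ sucℤ (h b))

  Walk : List A → Set
  Walk = Linked UnitStep

  AtMost : ℤ → A → Set
  AtMost t z = h z ≤ t

  Above : ℤ → A → Set
  Above t z = t < h z

  landsOn : ∀ {t x y} → h x ≤ t → t < h y → h y ≤ sucℤ (h x) → h x ≡ t
  landsOn x≤t t<y y≤sx = ≤-antisym x≤t (<-suc⇒≤ (<-≤-trans t<y y≤sx))

  firstReturn : ∀ t m S → Walk (m ∷ S) → t < h m → Any (AtMost t) S →
    ∃[ mid ] ∃[ b ] ∃[ ys ] (S ≡ mid ++ b ∷ ys × All (Above t) mid × h b ≡ t)
  firstReturn t m (y ∷ S) (step ∷ w) t<m reaches with h y ≤? t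
  ... | yes y≤t = [] , y , S , refl , [] , landsOn y≤t t<m (proj₂ step)
  ... | no y≰t with firstReturn t y S w (≰⇒> y≰t) (Any.tail y≰t reaches)
  ...   | mid , b , ys , refl , above , hb = y ∷ mid , b , ys , refl , ≰⇒> y≰t ∷ above , hb

  lastDeparture : ∀ t P m S → Walk (P ++ m ∷ S) → t < h m → Any (AtMost t) P →
    ∃[ xs ] ∃[ a ] ∃[ mid ] (P ≡ xs ++ a ∷ mid × h a ≡ t × All (Above t) mid)
  lastDeparture t (x ∷ []) m S (step ∷ _) t<m (here x≤t) =
    [] , x , [] , refl , landsOn x≤t t<m (proj₁ step) , []
  lastDeparture t (x ∷ y ∷ P) m S (step ∷ w) t<m reaches with any? (λ z → h z ≤? t) (y ∷ P)
  ... | yes later with lastDeparture t (y ∷ P) m S w t<m later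
  ...   | xs , a , mid , split , ha , above = x ∷ xs , a , mid , cong (x ∷_) split , ha , above
  lastDeparture t (x ∷ y ∷ P) m S (step ∷ w) t<m reaches | no none =
    [] , x , y ∷ P , refl , landsOn (Any.head none reaches) (All.head above) (proj₁ step) , above
    where
    above : All (Above t) (y ∷ P)
    above = All.map ≰⇒> (All.¬Any⇒All¬ (y ∷ P) none)

  record Excursion (t : ℤ) (m : A) (w : List A) : Set where
    field
      before after : List A
      start end    : A
      interior     : List A
      split        : w ≡ before ++ (start ∷ interior ++ [ end ]) ++ after
      startAt      : h start ≡ t
      endAt        : h end ≡ t
      interiorAbove : All (Above t) interior
      peakInside   : m ∈ interior

  excursion : ∀ t xs m S → Walk (xs ++ m ∷ S) → t < h m →
    Any (AtMost t) xs → Any (AtMost t) S → Excursion t m (xs ++ m ∷ S)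
  excursion t xs m S w t<m beforeM afterM
    with lastDeparture t xs m S w t<m beforeM | firstReturn t m S (linkedSuffix xs w) t<m afterM
  ... | pre , a , mid₁ , refl , ha , above₁ | mid₂ , b , post , refl , above₂ , hb = record
    { before = pre ; after = post ; start = a ; end = b ; interior = mid₁ ++ m ∷ mid₂
    ; split = regroup pre a mid₁ m mid₂ b post
    ; startAt = ha ; endAt = hb
    ; interiorAbove = All.++⁺ above₁ (t<m ∷ above₂)
    ; peakInside = ∈-++⁺ʳ mid₁ (here refl)
    }

  intermediateValue : ∀ q x rest → Walk (x ∷ rest) → h x ≤ q →
    Any (λ z → q ≤ h z) (x ∷ rest) → q ∈ map h (x ∷ rest)
  intermediateValue q x rest w x≤q reaches with h x ≟ q
  ... | yes x≡q = here (sym x≡q)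
  intermediateValue q x rest w x≤q (here q≤x) | no x≢q = ⊥-elim (x≢q (≤-antisym x≤q q≤x))
  intermediateValue q x (y ∷ rest) (step ∷ w) x≤q (there reaches) | no x≢q =
    there (intermediateValue q y rest w y≤q reaches)
    where
    y≤q : h y ≤ q
    y≤q = ≤-trans (proj₁ step) (i<j⇒suc[i]≤j (≤∧≢⇒< x≤q x≢q))

open module PositionWalks {N : ℕ} = UnitStepWalks (position {N})

placeWithin : ∀ {N} p (v : Var N) → p ≤ position (place p v) × position (place p v) ≤ p + + 1
placeWithin p (inj₁ _) = ≤-refl , i≤i+j p (+ 1)
placeWithin p (inj₂ _) = i≤i+j p (+ 1) , ≤-refl

withinWindow : ∀ {p a b} → p ≤ a → b ≤ p + + 1 → b ≤ sucℤ a
withinWindow {p} p≤a b≤p+1 = ≤-trans b≤p+1 (≤-trans (≤-reflexive (+-comm p 1ℤ)) (suc-mono p≤a))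

edgeUnitStep : ∀ {N} {R : DBC N} {a b} → Edge R a b → UnitStep a b
edgeUnitStep (edge p at _) =
  withinWindow (proj₁ (placeWithin p (Atom.lhs at))) (proj₂ (placeWithin p (Atom.rhs at))) ,
  withinWindow (proj₁ (placeWithin p (Atom.rhs at))) (proj₂ (placeWithin p (Atom.lhs at)))

excursionIsBasic : ∀ {N} {t} (a : Node N) (mid : List (Node N)) (b : Node N) →
  position a ≡ t → All (Above t) mid → IsBasic (a ∷ mid ++ [ b ])
excursionIsBasic a mid b refl above first middle last eq atStart
  with ∈-map⁻ position atStart
... | z , z∈middle , first≡z = <-irrefl (trans startSame first≡z) (All.lookup above z∈mid)
  where
  startSame : position a ≡ position first
  startSame = cong position (∷-injectiveˡ eq)

  z∈mid : z ∈ mid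
  z∈mid = subst (z ∈_) (sym (proj₁ (∷ʳ-injective mid middle (∷-injectiveʳ eq)))) z∈middle

excursionIsRightCorner : ∀ {N} (R : DBC N) t d (a : Node N) mid b →
  Linked (Edge R) (a ∷ mid ++ [ b ]) → position a ≡ t → position b ≡ t →
  All (Above t) mid → All (AtMost (t + + d)) (a ∷ mid ++ [ b ]) →
  Any (λ z → t + + d ≤ position z) (a ∷ mid ++ [ b ]) →
  IsRightCorner R t d (a ∷ mid ++ [ b ])
excursionIsRightCorner R t d a mid b path refl refl above belowTop reachesTop = record
  { corner = record
    { isPath = record { atLeastOneEdge = twoVertices mid ; consecutive = path }
    ; first = a ; middle = mid ; last = b ; shape = refl ; firstPos = refl ; lastPos = refl }
  ; positionSet = λ q → mk⇔ (inRange q) (attained q)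
  }
  where
  twoVertices : ∀ mid → 2 Data.Nat.≤ length (a ∷ mid ++ [ b ])
  twoVertices []      = s≤s (s≤s z≤n)
  twoVertices (_ ∷ _) = s≤s (s≤s z≤n)

  aboveBottom : All (λ z → position a ≤ position z) (a ∷ mid ++ [ b ])
  aboveBottom = ≤-refl ∷ All.++⁺ (All.map <⇒≤ above) (≤-refl ∷ [])

  inRange : ∀ q → q ∈ positions (a ∷ mid ++ [ b ]) → (position a ≤ q) × (q ≤ position a + + d)
  inRange q q∈ with ∈-map⁻ position q∈
  ... | z , z∈ , refl = All.lookup aboveBottom z∈ , All.lookup belowTop z∈

  attained : ∀ q → (position a ≤ q) × (q ≤ position a + + d) → q ∈ positions (a ∷ mid ++ [ b ])
  attained q (a≤q , q≤top) = intermediateValue q a (mid ++ [ b ]) (Linked.map edgeUnitStep path) a≤q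
    (Any.map (≤-trans q≤top) reachesTop)

peakCorner : ∀ {N} (R : DBC N) t d (ρ : List (Node N)) first middle last m →
  ρ ≡ first ∷ middle ++ [ last ] → Linked (Edge R) ρ →
  position first ≤ t → position last ≤ t → t < t + + d →
  All (AtMost (t + + d)) ρ → m ∈ ρ → position m ≡ t + + d →
  ∃[ ρ′ ] (Subpath ρ′ ρ × IsRightCorner R t d ρ′ × IsBasic ρ′)
peakCorner R t d ρ first middle last m shape path first≤t last≤t t<top belowTop m∈ρ m≡top
  with ∈-∃++ m∈ρ
... | xs , S , refl = ρ′ , (before , after , split) , rightCorner , basic
  where
  t<m : t < position m
  t<m = subst (t <_) (sym m≡top) t<top

  sides : Any (AtMost t) xs × Any (AtMost t) S
  sides = endsAround (AtMost t) middle xs S (sym shape) first≤t last≤t (<⇒≱ t<m)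

  open Excursion (excursion t xs m S (Linked.map edgeUnitStep path) t<m (proj₁ sides) (proj₂ sides))

  ρ′ : List (Node _)
  ρ′ = start ∷ interior ++ [ end ]

  rightCorner : IsRightCorner R t d ρ′
  rightCorner = excursionIsRightCorner R t d start interior end
    (linkedInfix before ρ′ (subst (Linked (Edge R)) split path)) startAt endAt interiorAbove
    (All.++⁻ˡ ρ′ (All.++⁻ʳ before (subst (All _) split belowTop)))
    (lose (there (∈-++⁺ˡ peakInside)) (≤-reflexive (sym m≡top)))

  basic : IsBasic ρ′
  basic = excursionIsBasic start interior end startAt interiorAbove

levelsSplit : ∀ k {e d} → d Data.Nat.≤ e → k + + e ≡ (k + + (e ∸ d)) + + d
levelsSplit k {e} {d} d≤e = begin
  k + + e                  ≡⟨ cong (λ n → k + + n) (sym (m∸n+n≡m d≤e)) ⟩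
  k + + (e ∸ d ℕ.+ d)      ≡⟨ cong (λ i → k + i) (pos-+ (e ∸ d) d) ⟩
  k + (+ (e ∸ d) + + d)    ≡⟨ sym (+-assoc k _ _) ⟩
  (k + + (e ∸ d)) + + d    ∎
  where open ≡-Reasoning

-- The right corner ρ lies between k and k + e = t + d and visits k + e, while its
-- endpoints sit at k ≤ t; the peak corner lemma does the rest.
proposition11 : ∀ {N : ℕ} (R : DBC N) (ρ : List (Node N)) (k : ℤ) (e : ℕ) →
    IsRightCorner R k e ρ →
    ∀ (d : ℕ) → 1 Data.Nat.≤ d → d Data.Nat.≤ e →
    ∃[ ρ' ] (Subpath ρ' ρ × IsRightCorner R (k + + (e ∸ d)) d ρ' × IsBasic ρ')
proposition11 R ρ k e rc d 1≤d d≤e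
  with ∈-map⁻ position (Equivalence.from (IsRightCorner.positionSet rc (k + + e)) (i≤i+j k (+ e) , ≤-refl))
... | m , m∈ρ , top≡m =
  peakCorner R t d ρ first middle last m shape consecutive
    (≤-trans (≤-reflexive firstPos) k≤t) (≤-trans (≤-reflexive lastPos) k≤t) t<top
    belowTop m∈ρ (trans (sym top≡m) top≡)
  where
  open IsRightCorner rc
  open IsCorner corner
  open IsPath isPath

  t : ℤ
  t = k + + (e ∸ d)

  top≡ : k + + e ≡ t + + d
  top≡ = levelsSplit k d≤e

  k≤t : k ≤ t
  k≤t = i≤i+j k (+ (e ∸ d))

  t<top : t < t + + d
  t<top = subst (_< t + + d) (+-identityʳ t) (+-monoʳ-< t (+<+ 1≤d))

  belowTop : All (AtMost (t + + d)) ρ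
  belowTop = All.tabulate (λ z∈ρ → subst (_ ≤_) top≡
    (proj₂ (Equivalence.to (positionSet _) (∈-map⁺ position z∈ρ))))
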